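{- Let $A\in{\sf ASM}(n)$. Then $\mathcal Ess(A)$ equals the set of pairs $(i,j)$ (with $1\le i,j\le n-1$, so that all quantities below are defined) such that \[r_A(i,j)=r_A(i-1,j)=r_A(i,j-1)\quad\text{and}\quad r_A(i,j)+1=r_A(i+1,j)=r_A(i,j+1).\]
   Context: An ASM of size $n$ is an $n\times n$ matrix $A=(a_{ij})$ with entries in $\{ -1,0,1\}$ whose nonzero entries alternate in sign along each row and column and each row and column sums to 1. $r_A(i,j)=\sum_{k\le i,\,l\le j}a_{kl}$, with the convention $r_A(i,j)=0$ if $i=0$ or $j=0$. $(i,j)$ is an inversion of $A$ if $\sum_{k>i,\,l>j}a_{il}a_{kj}=1$; $D(A)$ is the set of inversions; $\mathcal Ess(A)=\{(i,j)\in D(A):(i+1,j),(i,j+1)\notin D(A)\}$. -}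

module Defs where

open import Data.Nat using (ℕ; zero; suc; _<_; _≤_; _∸_; _<?_)
open import Data.Fin using (Fin; fromℕ<)
open import Data.Integer using (ℤ; _+_; _*_; -_; 0ℤ; 1ℤ; -1ℤ)
open import Data.Product using (_×_)
open import Data.Sum using (_⊎_)
open import Relation.Nullary using (¬_; yes; no)
open import Relation.Binary.PropositionalEquality using (_≡_; _≢_)

Matrix : ℕ → Set
Matrix n = Fin n → Fin n → ℤ

-- 1-indexed entry a_{ij}; equals 0 outside 1 ≤ i, j ≤ n.
entry : {n : ℕ} → Matrix n → ℕ → ℕ → ℤ
entry {n} A zero    _       = 0ℤ
entry {n} A (suc i) zero    = 0ℤ
entry {n} A (suc i) (suc j) with i <? n | j <? n
... | yes p | yes q = A (fromℕ< p) (fromℕ< q)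
... | _     | _     = 0ℤ

sumTo : ℕ → (ℕ → ℤ) → ℤ
sumTo zero    f = 0ℤ
sumTo (suc m) f = sumTo m f + f (suc m)

sumAbove : ℕ → ℕ → (ℕ → ℤ) → ℤ
sumAbove i n f = sumTo (n ∸ i) (λ t → f (i Data.Nat.+ t))

record IsASM (n : ℕ) (A : Matrix n) : Set where
  field
    entries   : ∀ i j → entry A i j ≡ 1ℤ ⊎ entry A i j ≡ 0ℤ ⊎ entry A i j ≡ -1ℤ
    rowSum    : ∀ i → 1 ≤ i → i ≤ n → sumTo n (λ l → entry A i l) ≡ 1ℤ
    colSum    : ∀ j → 1 ≤ j → j ≤ n → sumTo n (λ k → entry A k j) ≡ 1ℤ
    rowAlt    : ∀ i l l' → l < l' →
                entry A i l ≢ 0ℤ → entry A i l' ≢ 0ℤ →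
                (∀ m → l < m → m < l' → entry A i m ≡ 0ℤ) →
                entry A i l' ≡ - entry A i l
    colAlt    : ∀ j k k' → k < k' →
                entry A k j ≢ 0ℤ → entry A k' j ≢ 0ℤ →
                (∀ m → k < m → m < k' → entry A m j ≡ 0ℤ) →
                entry A k' j ≡ - entry A k j

-- r_A(i,j) = Σ_{k≤i, l≤j} a_{kl}  (so r_A(0,j) = r_A(i,0) = 0)
rank : {n : ℕ} → Matrix n → ℕ → ℕ → ℤ
rank A i j = sumTo i (λ k → sumTo j (λ l → entry A k l))

Inv : {n : ℕ} → Matrix n → ℕ → ℕ → Set
Inv {n} A i j =
  1 ≤ i × i ≤ n × 1 ≤ j × j ≤ n ×
  sumAbove i n (λ k → sumAbove j n (λ l → entry A i l * entry A k j)) ≡ 1ℤ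

Ess : {n : ℕ} → Matrix n → ℕ → ℕ → Set
Ess A i j = Inv A i j × ¬ Inv A (suc i) j × ¬ Inv A i (suc j)

module Submission where

-- Write R(i,j) = a_{i1} + … + a_{ij} for a partial row sum and
-- C(i,j) = a_{1j} + … + a_{ij} for a partial column sum.  The proof rests
-- on three observations.
--   1. The partial sums of a sequence whose nonzero terms alternate in sign
--      take at most two values, 0 and s; if the total is 1 then s = 1.  Hence
--      every partial row or column sum of an ASM is 0 or 1.
--   2. The inversion sum factorises as (1 - R(i,j)) * (1 - C(i,j)), so
--      (i,j) is an inversion iff R(i,j) = C(i,j) = 0.  Such a cell is never
--      in the last row or column, since full row and column sums are 1.
--   3. r(i,j) - r(i-1,j) = R(i,j) and r(i,j) - r(i,j-1) = C(i,j).
-- Given an inversion (i,j), the cell (i+1,j) fails to be one iff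
-- R(i+1,j) = 1 (a local 0/1 argument on a_{i+1,j}), and symmetrically for
-- (i,j+1).  This characterises Ess(A) by partial sums (essential⇔), and 3.
-- translates that characterisation into the rank conditions of the theorem.

open import Defs
open import Data.Nat using (ℕ; suc; _≤_; _∸_)
open import Data.Integer using (_+_; 1ℤ)
open import Data.Product using (_×_)
open import Function.Bundles using (_⇔_)
open import Relation.Binary.PropositionalEquality using (_≡_)

open import Data.Nat as ℕ using (zero; _<_; z≤n; s≤s)
import Data.Nat.Properties as ℕP
open import Data.Integer as ℤ using (ℤ; 0ℤ; -_; _*_)
import Data.Integer.Properties as ℤP
open import Data.Product using (Σ; _,_; proj₁; proj₂)
open import Data.Product.Function.NonDependent.Propositional using (_×-⇔_)
open import Data.Sum using (_⊎_; inj₁; inj₂)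
import Data.Sum as Sum
import Data.Product as Prod
open import Data.Empty using (⊥-elim)
open import Relation.Nullary using (¬_; yes; no)
open import Relation.Binary.PropositionalEquality
  using (refl; sym; trans; cong; cong₂; subst; _≢_)
open import Function.Bundles using (mk⇔; Equivalence)
import Function.Properties.Equivalence as ⇔
open import Algebra.Properties.CommutativeSemigroup ℤP.+-commutativeSemigroup
  using (interchange)
open import Algebra.Properties.AbelianGroup ℤP.+-0-abelianGroup
  using (∙-cancelˡ; identityʳ-unique)

ZeroOne : ℤ → Set
ZeroOne x = x ≡ 0ℤ ⊎ x ≡ 1ℤ

0≢1 : 0ℤ ≢ 1ℤ
0≢1 ()

zeroOne-sum-zero : ∀ {y a} → ZeroOne y → ZeroOne a → y + a ≡ 0ℤ → a ≡ 0ℤ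
zeroOne-sum-zero _           (inj₁ refl) _  = refl
zeroOne-sum-zero (inj₁ refl) (inj₂ refl) ()
zeroOne-sum-zero (inj₂ refl) (inj₂ refl) ()

shared-term-zero : ∀ {x y a} → ZeroOne y → ZeroOne (x + a) → x ≡ 0ℤ → y + a ≡ 0ℤ → x + a ≡ 0ℤ
shared-term-zero {a = a} y-bit x+a-bit refl y+a≡0 =
  trans (ℤP.+-identityˡ a)
        (zeroOne-sum-zero y-bit (subst ZeroOne (ℤP.+-identityˡ a) x+a-bit) y+a≡0)

Complementary : ℤ → ℤ → Set
Complementary x y = (x ≡ 0ℤ × y ≡ 1ℤ) ⊎ (x ≡ 1ℤ × y ≡ 0ℤ)

complementary : ∀ {x y} → ZeroOne x → x + y ≡ 1ℤ → Complementary x y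
complementary {y = y} (inj₁ refl) x+y≡1 = inj₁ (refl , trans (sym (ℤP.+-identityˡ y)) x+y≡1)
complementary {y = y} (inj₂ refl) x+y≡1 =
  inj₂ (refl , ∙-cancelˡ 1ℤ y 0ℤ (trans x+y≡1 (sym (ℤP.+-identityʳ 1ℤ))))

complements-product⇔ : ∀ {x x' y y'} → Complementary x x' → Complementary y y' →
                       (x' * y' ≡ 1ℤ) ⇔ (x ≡ 0ℤ × y ≡ 0ℤ)
complements-product⇔ (inj₁ (x≡0 , refl)) (inj₁ (y≡0 , refl)) =
  mk⇔ (λ _ → x≡0 , y≡0) (λ _ → refl)
complements-product⇔ (inj₁ (_ , refl)) (inj₂ (refl , refl)) = mk⇔ (λ ()) (λ ())
complements-product⇔ (inj₂ (refl , refl)) _        = mk⇔ (λ ()) (λ ())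

increment-zero⇔ : ∀ x {y d : ℤ} → y ≡ x + d → (d ≡ 0ℤ) ⇔ (y ≡ x)
increment-zero⇔ x {y} {d} y≡x+d = mk⇔ to from
  where
  to : d ≡ 0ℤ → y ≡ x
  to refl = trans y≡x+d (ℤP.+-identityʳ x)
  from : y ≡ x → d ≡ 0ℤ
  from y≡x = identityʳ-unique x d (trans (sym y≡x+d) y≡x)

increment-one⇔ : ∀ x {y d : ℤ} → y ≡ x + d → (d ≡ 1ℤ) ⇔ (x + 1ℤ ≡ y)
increment-one⇔ x {y} {d} y≡x+d = mk⇔ to from
  where
  to : d ≡ 1ℤ → x + 1ℤ ≡ y
  to refl = sym y≡x+d
  from : x + 1ℤ ≡ y → d ≡ 1ℤ
  from x+1≡y = sym (∙-cancelˡ x 1ℤ d (trans x+1≡y y≡x+d))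

<⇔≤∸1 : ∀ {m n} → (suc m < n) ⇔ (suc m ≤ n ∸ 1)
<⇔≤∸1 {n = zero}  = mk⇔ (λ ()) (λ ())
<⇔≤∸1 {n = suc n} = mk⇔ ℕP.≤-pred s≤s

sumTo-cong : ∀ m {f g : ℕ → ℤ} → (∀ t → f t ≡ g t) → sumTo m f ≡ sumTo m g
sumTo-cong zero    f≗g = refl
sumTo-cong (suc m) f≗g = cong₂ _+_ (sumTo-cong m f≗g) (f≗g (suc m))

sumTo-+ : ∀ m (f g : ℕ → ℤ) → sumTo m (λ t → f t + g t) ≡ sumTo m f + sumTo m g
sumTo-+ zero    f g = refl
sumTo-+ (suc m) f g = trans (cong (_+ (f (suc m) + g (suc m))) (sumTo-+ m f g))
                            (interchange (sumTo m f) (sumTo m g) (f (suc m)) (g (suc m)))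

sumTo-*ˡ : ∀ m (f : ℕ → ℤ) c → sumTo m (λ t → c * f t) ≡ c * sumTo m f
sumTo-*ˡ zero    f c = sym (ℤP.*-zeroʳ c)
sumTo-*ˡ (suc m) f c = trans (cong (_+ c * f (suc m)) (sumTo-*ˡ m f c))
                             (sym (ℤP.*-distribˡ-+ c (sumTo m f) (f (suc m))))

sumTo-*ʳ : ∀ m (f : ℕ → ℤ) c → sumTo m (λ t → f t * c) ≡ sumTo m f * c
sumTo-*ʳ zero    f c = sym (ℤP.*-zeroˡ c)
sumTo-*ʳ (suc m) f c = trans (cong (_+ f (suc m) * c) (sumTo-*ʳ m f c))
                             (sym (ℤP.*-distribʳ-+ c (sumTo m f) (f (suc m))))

sumTo-split : ∀ j m (f : ℕ → ℤ) →
              sumTo (j ℕ.+ m) f ≡ sumTo j f + sumTo m (λ t → f (j ℕ.+ t))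
sumTo-split j zero    f rewrite ℕP.+-identityʳ j = sym (ℤP.+-identityʳ (sumTo j f))
sumTo-split j (suc m) f rewrite ℕP.+-suc j m =
  trans (cong (_+ f (suc (j ℕ.+ m))) (sumTo-split j m f)) (ℤP.+-assoc (sumTo j f) _ _)

sumTo-sumAbove : ∀ {j n} (f : ℕ → ℤ) → j ≤ n → sumTo j f + sumAbove j n f ≡ sumTo n f
sumTo-sumAbove {j} {n} f j≤n =
  trans (sym (sumTo-split j (n ∸ j) f)) (cong (λ k → sumTo k f) (ℕP.m+[n∸m]≡n j≤n))

Alternating : (ℕ → ℤ) → Set
Alternating f = ∀ l l' → l < l' → f l ≢ 0ℤ → f l' ≢ 0ℤ →
                (∀ m → l < m → m < l' → f m ≡ 0ℤ) → f l' ≡ - f l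

extend : ∀ {J} {Q : ℕ → Set} → (∀ j → j ≤ J → Q j) → Q (suc J) → ∀ j → j ≤ suc J → Q j
extend {J} below here j j≤1+J with ℕP.m≤n⇒m<n∨m≡n j≤1+J
... | inj₁ j<1+J = below j (ℕP.≤-pred j<1+J)
... | inj₂ refl  = here

module AlternatingSums (f : ℕ → ℤ) (alternating : Alternating f) where

  P : ℕ → ℤ
  P j = sumTo j f

  LastNonzero : ℕ → ℕ → Set
  LastNonzero J l = l ≤ J × f l ≢ 0ℤ × (∀ m → l < m → m ≤ J → f m ≡ 0ℤ)

  -- Relative to the sign s of the first nonzero term, the partial sum P J
  -- is s right after a term of sign s, and 0 right after a term of sign -s.
  Phase : ℕ → ℕ → ℤ → Set
  Phase J l s = (f l ≡ s × P J ≡ s) ⊎ (f l ≡ - s × P J ≡ 0ℤ)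

  phase-value : ∀ {J l s} → Phase J l s → P J ≡ 0ℤ ⊎ P J ≡ s
  phase-value (inj₁ (_ , PJ≡s)) = inj₂ PJ≡s
  phase-value (inj₂ (_ , PJ≡0)) = inj₁ PJ≡0

  Silent : ℕ → Set
  Silent J = ∀ j → j ≤ J → P j ≡ 0ℤ

  Signed : ℕ → ℤ → Set
  Signed J s = (∀ j → j ≤ J → P j ≡ 0ℤ ⊎ P j ≡ s) ×
               Σ ℕ λ l → LastNonzero J l × Phase J l s

  newest-nonzero : ∀ {J} → f (suc J) ≢ 0ℤ → LastNonzero (suc J) (suc J)
  newest-nonzero f≢0 = ℕP.≤-refl , f≢0 , λ m J<m m≤J → ⊥-elim (ℕP.<⇒≱ J<m m≤J)

  skip-zero : ∀ {J l s} → f (suc J) ≡ 0ℤ → LastNonzero J l × Phase J l s →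
              LastNonzero (suc J) l × Phase (suc J) l s
  skip-zero {J} {l} f≡0 ((l≤J , fl≢0 , zeros) , phase) =
    (ℕP.m≤n⇒m≤1+n l≤J , fl≢0 , zeros′) ,
    Sum.map (Prod.map₂ (trans same)) (Prod.map₂ (trans same)) phase
    where
    same : P (suc J) ≡ P J
    same = trans (cong (P J +_) f≡0) (ℤP.+-identityʳ (P J))
    zeros′ : ∀ m → l < m → m ≤ suc J → f m ≡ 0ℤ
    zeros′ m l<m m≤1+J =
      extend {Q = λ m → l < m → f m ≡ 0ℤ} (λ m m≤J l<m → zeros m l<m m≤J) (λ _ → f≡0)
             m m≤1+J l<m

  -- A nonzero term is opposite to the previous one, so it flips the phase.
  flip-nonzero : ∀ {J l s} → f (suc J) ≢ 0ℤ → LastNonzero J l × Phase J l s →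
                 LastNonzero (suc J) (suc J) × Phase (suc J) (suc J) s
  flip-nonzero {J} {l} {s} f≢0 ((l≤J , fl≢0 , zeros) , phase) =
    newest-nonzero f≢0 , flip phase
    where
    opposite : f (suc J) ≡ - f l
    opposite = alternating l (suc J) (s≤s l≤J) fl≢0 f≢0
                 (λ m l<m m<1+J → zeros m l<m (ℕP.≤-pred m<1+J))
    flip : Phase J l s → Phase (suc J) (suc J) s
    flip (inj₁ (fl≡s , PJ≡s)) =
      inj₂ (next≡-s , trans (cong₂ _+_ PJ≡s next≡-s) (ℤP.+-inverseʳ s))
      where next≡-s = trans opposite (cong -_ fl≡s)
    flip (inj₂ (fl≡-s , PJ≡0)) =
      inj₁ (next≡s , trans (cong₂ _+_ PJ≡0 next≡s) (ℤP.+-identityˡ s))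
      where next≡s = trans opposite (trans (cong -_ fl≡-s) (ℤP.neg-involutive s))

  signed-step : ∀ {J s} → Signed J s → Signed (suc J) s
  signed-step {J} (sums , l , current) with f (suc J) ℤ.≟ 0ℤ
  ... | yes f≡0 = let next = skip-zero f≡0 current
                  in extend sums (phase-value {suc J} (proj₂ next)) , l , next
  ... | no  f≢0 = let next = flip-nonzero f≢0 current
                  in extend sums (phase-value {suc J} (proj₂ next)) , suc J , next

  silent-step : ∀ {J} → Silent J → Silent (suc J) ⊎ Σ ℤ (Signed (suc J))
  silent-step {J} silent with f (suc J) ℤ.≟ 0ℤ
  ... | yes f≡0 = inj₁ (extend silent (cong₂ _+_ (silent J ℕP.≤-refl) f≡0))
  ... | no  f≢0 = inj₂ (f (suc J) , extend (λ j j≤J → inj₁ (silent j j≤J)) (inj₂ P≡f) ,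
                        suc J , newest-nonzero f≢0 ,
                        inj₁ (refl , P≡f))
    where
    P≡f : P (suc J) ≡ f (suc J)
    P≡f = trans (cong (_+ f (suc J)) (silent J ℕP.≤-refl)) (ℤP.+-identityˡ (f (suc J)))

  prefix : ∀ J → Silent J ⊎ Σ ℤ (Signed J)
  prefix zero    = inj₁ λ { .zero z≤n → refl }
  prefix (suc J) with prefix J
  ... | inj₁ silent       = silent-step silent
  ... | inj₂ (s , signed) = inj₂ (s , signed-step signed)

  partialSums-zeroOne : ∀ N → P N ≡ 1ℤ → ∀ j → j ≤ N → ZeroOne (P j)
  partialSums-zeroOne N PN≡1 j j≤N with prefix N
  ... | inj₁ silent = ⊥-elim (0≢1 (trans (sym (silent N ℕP.≤-refl)) PN≡1))
  ... | inj₂ (s , sums , _) with sums N ℕP.≤-refl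
  ...   | inj₁ PN≡0 = ⊥-elim (0≢1 (trans (sym PN≡0) PN≡1))
  ...   | inj₂ PN≡s = Sum.map₂ (λ Pj≡s → trans Pj≡s (trans (sym PN≡s) PN≡1)) (sums j j≤N)

module EssentialSet (n : ℕ) (A : Matrix n) (asm : IsASM n A) where
  open IsASM asm

  a : ℕ → ℕ → ℤ
  a = entry A

  R C rowTail colTail : ℕ → ℕ → ℤ
  R i j       = sumTo j (λ l → a i l)
  C i j       = sumTo i (λ k → a k j)
  rowTail i j = sumAbove j n (λ l → a i l)
  colTail i j = sumAbove i n (λ k → a k j)

  rowPartial-zeroOne : ∀ {i j} → 1 ≤ i → i ≤ n → j ≤ n → ZeroOne (R i j)
  rowPartial-zeroOne {i} {j} 1≤i i≤n j≤n =
    AlternatingSums.partialSums-zeroOne (λ l → a i l) (rowAlt i) n (rowSum i 1≤i i≤n) j j≤n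

  colPartial-zeroOne : ∀ {i j} → 1 ≤ j → j ≤ n → i ≤ n → ZeroOne (C i j)
  colPartial-zeroOne {i} {j} 1≤j j≤n i≤n =
    AlternatingSums.partialSums-zeroOne (λ k → a k j) (colAlt j) n (colSum j 1≤j j≤n) i i≤n

  -- Since full rows and columns sum to 1, each tail complements its prefix.
  row-complementary : ∀ {i j} → 1 ≤ i → i ≤ n → j ≤ n → Complementary (R i j) (rowTail i j)
  row-complementary {i} 1≤i i≤n j≤n =
    complementary (rowPartial-zeroOne 1≤i i≤n j≤n)
                  (trans (sumTo-sumAbove (λ l → a i l) j≤n) (rowSum i 1≤i i≤n))

  col-complementary : ∀ {i j} → 1 ≤ j → j ≤ n → i ≤ n → Complementary (C i j) (colTail i j)
  col-complementary {j = j} 1≤j j≤n i≤n =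
    complementary (colPartial-zeroOne 1≤j j≤n i≤n)
                  (trans (sumTo-sumAbove (λ k → a k j) i≤n) (colSum j 1≤j j≤n))

  inversionSum-factor : ∀ i j →
    sumAbove i n (λ k → sumAbove j n (λ l → a i l * a k j)) ≡ rowTail i j * colTail i j
  inversionSum-factor i j =
    trans (sumTo-cong (n ∸ i) (λ t → sumTo-*ʳ (n ∸ j) (λ u → a i (j ℕ.+ u)) (a (i ℕ.+ t) j)))
          (sumTo-*ˡ (n ∸ i) (λ t → a (i ℕ.+ t) j) (rowTail i j))

  inversionSum⇔ : ∀ {i j} → 1 ≤ i → i ≤ n → 1 ≤ j → j ≤ n →
    (sumAbove i n (λ k → sumAbove j n (λ l → a i l * a k j)) ≡ 1ℤ) ⇔ (R i j ≡ 0ℤ × C i j ≡ 0ℤ)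
  inversionSum⇔ {i} {j} 1≤i i≤n 1≤j j≤n =
    ⇔.trans (mk⇔ (trans (sym (inversionSum-factor i j))) (trans (inversionSum-factor i j)))
            (complements-product⇔ (row-complementary 1≤i i≤n j≤n)
                                  (col-complementary 1≤j j≤n i≤n))

  inversion-partialSums : ∀ {i j} → Inv A i j → R i j ≡ 0ℤ × C i j ≡ 0ℤ
  inversion-partialSums (1≤i , i≤n , 1≤j , j≤n , sum≡1) =
    Equivalence.to (inversionSum⇔ 1≤i i≤n 1≤j j≤n) sum≡1

  partialSums-inversion : ∀ {i j} → 1 ≤ i → i ≤ n → 1 ≤ j → j ≤ n →
                          R i j ≡ 0ℤ → C i j ≡ 0ℤ → Inv A i j
  partialSums-inversion 1≤i i≤n 1≤j j≤n R≡0 C≡0 =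
    1≤i , i≤n , 1≤j , j≤n , Equivalence.from (inversionSum⇔ 1≤i i≤n 1≤j j≤n) (R≡0 , C≡0)

  -- An inversion is never in the last row or column, whose prefix sums are 1.
  inversion-interior : ∀ {i j} → Inv A i j → i < n × j < n
  inversion-interior inv@(1≤i , i≤n , 1≤j , j≤n , _) =
    ℕP.≤∧≢⇒< i≤n (λ { refl → 0≢1 (trans (sym C≡0) (colSum _ 1≤j j≤n)) }) ,
    ℕP.≤∧≢⇒< j≤n (λ { refl → 0≢1 (trans (sym R≡0) (rowSum _ 1≤i i≤n)) })
    where
    R≡0 = proj₁ (inversion-partialSums inv)
    C≡0 = proj₂ (inversion-partialSums inv)

  -- If C(I,J) = 0, the cell (I+1,J) is an inversion unless R(I+1,J) = 1:
  -- when R(I+1,J) = 0 the entry a_{I+1,J} vanishes, so C(I+1,J) = 0 too.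
  below-rowPartial : ∀ {I j} → suc I ≤ n → suc j ≤ n → C I (suc j) ≡ 0ℤ →
                     ¬ Inv A (suc I) (suc j) → R (suc I) (suc j) ≡ 1ℤ
  below-rowPartial {I} {j} 1+I≤n 1+j≤n C≡0 not-inv
    with rowPartial-zeroOne (s≤s z≤n) 1+I≤n 1+j≤n
  ... | inj₂ R≡1 = R≡1
  ... | inj₁ R≡0 =
    ⊥-elim (not-inv (partialSums-inversion (s≤s z≤n) 1+I≤n (s≤s z≤n) 1+j≤n R≡0 C′≡0))
    where
    C′≡0 : C (suc I) (suc j) ≡ 0ℤ
    C′≡0 = shared-term-zero (rowPartial-zeroOne (s≤s z≤n) 1+I≤n (ℕP.<⇒≤ 1+j≤n))
                            (colPartial-zeroOne (s≤s z≤n) 1+j≤n 1+I≤n) C≡0 R≡0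

  right-colPartial : ∀ {i J} → suc i ≤ n → suc J ≤ n → R (suc i) J ≡ 0ℤ →
                     ¬ Inv A (suc i) (suc J) → C (suc i) (suc J) ≡ 1ℤ
  right-colPartial {i} {J} 1+i≤n 1+J≤n R≡0 not-inv
    with colPartial-zeroOne (s≤s z≤n) 1+J≤n 1+i≤n
  ... | inj₂ C≡1 = C≡1
  ... | inj₁ C≡0 =
    ⊥-elim (not-inv (partialSums-inversion (s≤s z≤n) 1+i≤n (s≤s z≤n) 1+J≤n R′≡0 C≡0))
    where
    R′≡0 : R (suc i) (suc J) ≡ 0ℤ
    R′≡0 = shared-term-zero (colPartial-zeroOne (s≤s z≤n) 1+J≤n (ℕP.<⇒≤ 1+i≤n))
                            (rowPartial-zeroOne (s≤s z≤n) 1+i≤n 1+J≤n) R≡0 C≡0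

  essential⇔ : ∀ i j → let I = suc i; J = suc j in
    Ess A I J ⇔ (1 ≤ I × I < n × 1 ≤ J × J < n ×
                 R I J ≡ 0ℤ × C I J ≡ 0ℤ × R (suc I) J ≡ 1ℤ × C I (suc J) ≡ 1ℤ)
  essential⇔ i j = mk⇔ to from
    where
    I = suc i
    J = suc j
    to : Ess A I J → _
    to (inv@(1≤I , _ , 1≤J , J≤n , _) , not-below , not-right) =
      1≤I , I<n , 1≤J , J<n , R≡0 , C≡0 ,
      below-rowPartial I<n J≤n C≡0 not-below , right-colPartial (ℕP.<⇒≤ I<n) J<n R≡0 not-right
      where
      R≡0 = proj₁ (inversion-partialSums inv)
      C≡0 = proj₂ (inversion-partialSums inv)
      I<n = proj₁ (inversion-interior inv)
      J<n = proj₂ (inversion-interior inv)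
    from : _ → Ess A I J
    from (1≤I , I<n , 1≤J , J<n , R≡0 , C≡0 , R′≡1 , C′≡1) =
      partialSums-inversion 1≤I (ℕP.<⇒≤ I<n) 1≤J (ℕP.<⇒≤ J<n) R≡0 C≡0 ,
      (λ inv → 0≢1 (trans (sym (proj₁ (inversion-partialSums inv))) R′≡1)) ,
      (λ inv → 0≢1 (trans (sym (proj₂ (inversion-partialSums inv))) C′≡1))

  rank-down : ∀ i j → rank A (suc i) j ≡ rank A i j + R (suc i) j
  rank-down i j = refl

  rank-right : ∀ i j → rank A i (suc j) ≡ rank A i j + C i (suc j)
  rank-right i j = sumTo-+ i (λ k → sumTo j (λ l → a k l)) (λ k → a k (suc j))

lemma3p7 : (n : ℕ) (A : Matrix n) → IsASM n A → (i j : ℕ) →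
    Ess A i j ⇔
      (1 ≤ i × i ≤ n ∸ 1 × 1 ≤ j × j ≤ n ∸ 1 ×
       rank A i j ≡ rank A (i ∸ 1) j × rank A i j ≡ rank A i (j ∸ 1) ×
       rank A i j + 1ℤ ≡ rank A (suc i) j × rank A i j + 1ℤ ≡ rank A i (suc j))
lemma3p7 n A asm zero    j       = mk⇔ (λ { ((() , _) , _) }) (λ { (() , _) })
lemma3p7 n A asm (suc i) zero    = mk⇔ (λ { ((_ , _ , () , _) , _) }) (λ { (_ , _ , () , _) })
lemma3p7 n A asm (suc i) (suc j) =
  ⇔.trans (essential⇔ i j)
    (⇔.refl ×-⇔ <⇔≤∸1 ×-⇔ ⇔.refl ×-⇔ <⇔≤∸1 ×-⇔
     increment-zero⇔ _ (rank-down i (suc j)) ×-⇔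
     increment-zero⇔ _ (rank-right (suc i) j) ×-⇔
     increment-one⇔ (rank A (suc i) (suc j)) (rank-down (suc i) (suc j)) ×-⇔
     increment-one⇔ (rank A (suc i) (suc j)) (rank-right (suc i) (suc j)))
  where open EssentialSet n A asm
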